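{- Let $r$ be a positive integer and let $D$ be a finite digraph with no $(r-1)$-source sets. Then $D$ contains $r$ pairwise disjoint $2^{r+1}$-kernels.
   Context: For a set $S$ of vertices, $N^-(S)=\{u\in V(D)\setminus S:\ \exists v\in S,\ uv\in E(D)\}$. A set $S\subseteq V(D)$ is a source set if $N^-(S)=\emptyset$; it is an $s$-source set if moreover $S$ is non-empty and $|S|\le s$. A set of vertices is independent if there are no arcs between two of its vertices. $\mathrm{dist}(u,v)$ is the length of a shortest directed path from $u$ to $v$, and $\mathrm{dist}(S,v)=\min_{u\in S}\mathrm{dist}(u,v)$. For an integer $q\ge 1$, a $q$-kernel is an independent set $Q$ with $\mathrm{dist}(Q,v)\le q$ for all $v\in V(D)$. -}

module Defs where

open import Data.Nat using (ℕ; zero; suc; _≤_)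
open import Data.Bool using (Bool; true; false)
open import Data.Fin using (Fin)
open import Data.Fin.Subset using (Subset; _∈_; _∉_; ∣_∣)
open import Data.Product using (Σ; _×_; ∃; ∃-syntax)
open import Relation.Nullary using (¬_)
open import Relation.Binary.PropositionalEquality using (_≡_)

record Digraph : Set where
  field
    n     : ℕ
    arc?  : Fin n → Fin n → Bool
    loopless : ∀ v → arc? v v ≡ false

open Digraph public

Arc : (D : Digraph) → Fin (n D) → Fin (n D) → Set
Arc D u v = arc? D u v ≡ true

VSet : Digraph → Set
VSet D = Subset (n D)

InNeg : (D : Digraph) → VSet D → Fin (n D) → Set
InNeg D S u = u ∉ S × ∃[ v ] (v ∈ S × Arc D u v)

IsSourceSet : (D : Digraph) → VSet D → Set
IsSourceSet D S = ∀ u → ¬ InNeg D S u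

IsSSourceSet : (D : Digraph) → ℕ → VSet D → Set
IsSSourceSet D s S = IsSourceSet D S × (∃[ v ] v ∈ S) × ∣ S ∣ ≤ s

NoSSourceSet : Digraph → ℕ → Set
NoSSourceSet D s = ∀ S → ¬ IsSSourceSet D s S

Independent : (D : Digraph) → VSet D → Set
Independent D Q = ∀ u v → u ∈ Q → v ∈ Q → ¬ Arc D u v

data Walk (D : Digraph) : Fin (n D) → Fin (n D) → ℕ → Set where
  here : ∀ {u} → Walk D u u zero
  step : ∀ {u w v k} → Arc D u w → Walk D w v k → Walk D u v (suc k)

-- dist(u,v) ≤ q  (a shortest directed path has length ≤ q iff some walk of length ≤ q exists)
DistLe : (D : Digraph) → Fin (n D) → Fin (n D) → ℕ → Set
DistLe D u v q = ∃[ k ] (k ≤ q × Walk D u v k)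

DistSetLe : (D : Digraph) → VSet D → Fin (n D) → ℕ → Set
DistSetLe D S v q = ∃[ u ] (u ∈ S × DistLe D u v q)

IsQKernel : (D : Digraph) → ℕ → VSet D → Set
IsQKernel D q Q = Independent D Q × (∀ v → DistSetLe D Q v q)

PairwiseDisjoint : (D : Digraph) → {r : ℕ} → (Fin r → VSet D) → Set
PairwiseDisjoint D {r} K = ∀ i j → ¬ i ≡ j → ∀ v → v ∈ K i → ¬ v ∈ K j

-- Induction on r, relative to an active vertex set A. A Chvátal–Lovász quasi-kernel Q of the
-- digraph of walks of length at most r − 1 in A is independent and reaches A within 2(r − 1)
-- steps. Delete Q and add an arc u → w whenever u → x → w with x ∈ Q. The contraction has no
-- (r − 2)-source sets in A ∖ Q: an arc from u ∈ Q into a small source T would make the set of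
-- vertices of T reaching u within k steps grow strictly for every k < r − 1, beyond ∣T∣. The r − 1
-- kernels of the contraction given by induction are independent in D, and expanding contracted
-- arcs at most doubles distances, plus one arc into Q from an in-neighbour outside Q. Hence the
-- radius satisfies ρ(r) = 2ρ(r − 1) + 2 = 2^(r+1) − 2.

module Submission where

open import Defs hiding (n) renaming (Walk to DigraphWalk)
open import Level using (0ℓ)
open import Data.Nat using (ℕ; zero; suc; _+_; _*_; _^_; _∸_; _≤_; _<_; z≤n; s≤s)
open import Data.Nat.Properties
  using (≤-refl; ≤-reflexive; ≤-trans; ≤-pred; ≤-<-trans; <-≤-trans; m<n⇒m<1+n; m≤n⇒m≤1+n; n≤1+n; 1+n≰n; m≤m+n; m≤m*n;
         +-suc; +-assoc; +-comm; +-mono-≤; +-monoˡ-≤; +-monoʳ-≤; *-comm; *-distribʳ-+; *-monoˡ-≤; module ≤-Reasoning)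
open import Data.Bool using (true)
import Data.Bool.Properties as Bool
open import Data.Fin using (Fin; zero; suc; _≟_)
open import Data.Fin.Properties using (any?)
open import Data.Fin.Subset using (Subset; _∈_; _∉_; _⊆_; _⊂_; _∪_; _∩_; _─_; ⁅_⁆; ⊤; ⊥; ∣_∣; Nonempty; inside; outside)
open import Data.Fin.Subset.Properties
  using (_∈?_; nonempty?; ∉⊥; ∈⊤; x∈⁅x⁆; x∈⁅y⁆⇒x≡y; x∉⁅y⁆⇒x≢y; ∣⁅x⁆∣≡1; p⊆p∪q; q⊆p∪q; x∈p∪q⁻; p∩q⊆p; x∈p∩q⁺; x∈p∩q⁻;
         p⊆q⇒∣p∣≤∣q∣; p⊂q⇒∣p∣<∣q∣; x∈p∧x∉q⇒x∈p─q; p─q⊆p; p∩q≢∅⇒∣p─q∣<∣p∣)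
open import Data.Vec using (tabulate; []; _∷_; here; there)
import Data.Vec.Functional as Vector
open import Data.Vec.Properties using (lookup∘tabulate; []=⇒lookup; lookup⇒[]=)
open import Data.Product using (_×_; _,_; proj₁; proj₂; ∃-syntax; map₁; map₂)
open import Data.Sum using (_⊎_; inj₁; inj₂)
open import Function using (_∘_; id)
open import Relation.Binary using (Rel; Decidable)
open import Relation.Binary.PropositionalEquality using (_≡_; _≢_; refl; sym; trans; cong; subst; module ≡-Reasoning)
open import Relation.Nullary using (¬_; Dec; yes; no; does; ¬?; contradiction)
open import Relation.Nullary.Decidable using (map′; _×-dec_; _⊎-dec_; dec-true; decidable-stable)
open import Relation.Unary using (Pred)
import Relation.Unary as U

private variable
  n k l q q′ s m M : ℕ
  R S : Rel (Fin n) 0ℓ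
  A Q T : Subset n
  u v w x : Fin n

x∈p─q⇒x∉q : ∀ (p q : Subset n) → x ∈ p ─ q → x ∉ q
x∈p─q⇒x∉q (inside ∷ p) (outside ∷ q) here         ()
x∈p─q⇒x∉q (_ ∷ p)      (_ ∷ q)       (there x∈p─q) (there x∈q) = x∈p─q⇒x∉q p q x∈p─q x∈q

∣p∪q∣≤∣p∣+∣q∣ : ∀ (p q : Subset n) → ∣ p ∪ q ∣ ≤ ∣ p ∣ + ∣ q ∣
∣p∪q∣≤∣p∣+∣q∣ []            []            = z≤n
∣p∪q∣≤∣p∣+∣q∣ (outside ∷ p) (outside ∷ q) = ∣p∪q∣≤∣p∣+∣q∣ p q
∣p∪q∣≤∣p∣+∣q∣ (inside ∷ p)  (outside ∷ q) = s≤s (∣p∪q∣≤∣p∣+∣q∣ p q)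
∣p∪q∣≤∣p∣+∣q∣ (outside ∷ p) (inside ∷ q)  =
  subst (suc ∣ p ∪ q ∣ ≤_) (sym (+-suc ∣ p ∣ ∣ q ∣)) (s≤s (∣p∪q∣≤∣p∣+∣q∣ p q))
∣p∪q∣≤∣p∣+∣q∣ (inside ∷ p)  (inside ∷ q)  =
  s≤s (≤-trans (∣p∪q∣≤∣p∣+∣q∣ p q) (+-monoʳ-≤ ∣ p ∣ (n≤1+n ∣ q ∣)))

x∈p⇒x∈p─q⊎x∈q : ∀ {p} (q : Subset n) → x ∈ p → x ∈ p ─ q ⊎ x ∈ q
x∈p⇒x∈p─q⊎x∈q {x = x} q x∈p with x ∈? q
... | yes x∈q = inj₂ x∈q
... | no  x∉q = inj₁ (x∈p∧x∉q⇒x∈p─q x∈p x∉q)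

x∈p⇒⁅x⁆⊆p : ∀ {p} → x ∈ p → ⁅ x ⁆ ⊆ p
x∈p⇒⁅x⁆⊆p {x = x} {p} x∈p y∈⁅x⁆ = subst (_∈ p) (sym (x∈⁅y⁆⇒x≡y x y∈⁅x⁆)) x∈p

x∈⁅y⁆∪p⁻ : ∀ {p} → x ∈ ⁅ v ⁆ ∪ p → x ≡ v ⊎ x ∈ p
x∈⁅y⁆∪p⁻ {v = v} {p} x∈ with x∈p∪q⁻ ⁅ v ⁆ p x∈
... | inj₁ x∈⁅v⁆ = inj₁ (x∈⁅y⁆⇒x≡y v x∈⁅v⁆)
... | inj₂ x∈p   = inj₂ x∈p

strict-chain-size : (C : ℕ → Subset n) → (∀ {k} → k < s → C k ⊂ C (suc k)) → s ≤ ∣ C s ∣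
strict-chain-size {s = zero}  C grows = z≤n
strict-chain-size {s = suc s} C grows =
  ≤-<-trans (strict-chain-size C (grows ∘ m<n⇒m<1+n)) (p⊂q⇒∣p∣<∣q∣ (grows ≤-refl))

select : ∀ {ℓ} {P : Pred (Fin n) ℓ} → U.Decidable P → Subset n
select P? = tabulate (does ∘ P?)

module _ {ℓ} {P : Pred (Fin n) ℓ} (P? : U.Decidable P) where

  ∈-select⁺ : P x → x ∈ select P?
  ∈-select⁺ {x} px = lookup⇒[]= x _ (trans (lookup∘tabulate (does ∘ P?) x) (dec-true (P? x) px))

  ∈-select⁻ : x ∈ select P? → P x
  ∈-select⁻ {x} x∈ with P? x | trans (sym (lookup∘tabulate (does ∘ P?) x)) ([]=⇒lookup x∈)
  ... | yes px | _ = px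
  ... | no _   | ()

data Walk {n : ℕ} (R : Rel (Fin n) 0ℓ) : Fin n → Fin n → ℕ → Set where
  []  : Walk R u u 0
  _◅_ : R u w → Walk R w v k → Walk R u v (suc k)

infixr 5 _◅_ _◅◅_

_◅◅_ : Walk R u w k → Walk R w v l → Walk R u v (k + l)
[]      ◅◅ q = q
(e ◅ p) ◅◅ q = e ◅ (p ◅◅ q)

Within : Rel (Fin n) 0ℓ → ℕ → Rel (Fin n) 0ℓ
Within R q u v = ∃[ k ] (k ≤ q × Walk R u v k)

within-refl : Within R q u u
within-refl = 0 , z≤n , []

within-◅ : R u w → Within R q w v → Within R (suc q) u v
within-◅ e (k , k≤q , p) = suc k , s≤s k≤q , e ◅ p

arc⇒within : R u v → Within R (suc q) u v
arc⇒within e = within-◅ e within-refl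

within-mono : q ≤ q′ → Within R q u v → Within R q′ u v
within-mono q≤q′ (k , k≤q , p) = k , ≤-trans k≤q q≤q′ , p

within-◅◅ : Within R q u w → Within R q′ w v → Within R (q + q′) u v
within-◅◅ (k , k≤q , p) (l , l≤q′ , p′) = k + l , +-mono-≤ k≤q l≤q′ , p ◅◅ p′

walk-flatten : (∀ {x y} → S x y → Within R M x y) → Walk S u v k → Within R (k * M) u v
walk-flatten S⇒R []      = within-refl
walk-flatten S⇒R (e ◅ p) = within-◅◅ (S⇒R e) (walk-flatten S⇒R p)

within-flatten : (∀ {x y} → S x y → Within R M x y) → Within S q u v → Within R (q * M) u v
within-flatten {M = M} S⇒R (k , k≤q , p) = within-mono (*-monoˡ-≤ M k≤q) (walk-flatten S⇒R p)

within? : Decidable R → ∀ q → Decidable (Within R q)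
within? R? zero u v = map′ (λ { refl → within-refl }) (λ { (zero , _ , []) → refl ; (suc _ , () , _) }) (u ≟ v)
within? {R = R} R? (suc q) u v = map′ from to (u ≟ v ⊎-dec any? λ w → R? u w ×-dec within? R? q w v)
  where
  from : u ≡ v ⊎ ∃[ w ] (R u w × Within R q w v) → Within R (suc q) u v
  from (inj₁ refl)        = within-refl
  from (inj₂ (_ , e , r)) = within-◅ e r
  to : Within R (suc q) u v → u ≡ v ⊎ ∃[ w ] (R u w × Within R q w v)
  to (zero  , _         , [])    = inj₁ refl
  to (suc k , s≤s k≤q , e ◅ p) = inj₂ (_ , e , k , k≤q , p)

IndependentSet : Rel (Fin n) 0ℓ → Subset n → Set
IndependentSet R Q = ∀ {u w} → u ∈ Q → w ∈ Q → u ≢ w → ¬ R u w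

independent-anti : (∀ {x y} → R x y → S x y) → IndependentSet S Q → IndependentSet R Q
independent-anti R⇒S Q-ind u∈Q w∈Q u≢w = Q-ind u∈Q w∈Q u≢w ∘ R⇒S

ReachesWithin : Rel (Fin n) 0ℓ → ℕ → Subset n → Subset n → Set
ReachesWithin R q Q A = ∀ {v} → v ∈ A → ∃[ u ] (u ∈ Q × Within R q u v)

IsKernelIn : Rel (Fin n) 0ℓ → ℕ → Subset n → Subset n → Set
IsKernelIn R q A Q = Q ⊆ A × IndependentSet R Q × ReachesWithin R q Q A

HasInNeighbour : Rel (Fin n) 0ℓ → Subset n → Subset n → Set
HasInNeighbour R A T = ∃[ y ] ∃[ t ] (y ∈ A × y ∉ T × t ∈ T × R y t)

hasInNeighbour? : Decidable R → ∀ A T → Dec (HasInNeighbour R A T)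
hasInNeighbour? R? A T = any? λ y → any? λ t → y ∈? A ×-dec ¬? (y ∈? T) ×-dec t ∈? T ×-dec R? y t

NoSmallSource : Rel (Fin n) 0ℓ → Subset n → ℕ → Set
NoSmallSource R A s = ∀ {T} → T ⊆ A → Nonempty T → ∣ T ∣ ≤ s → HasInNeighbour R A T

in-neighbour : NoSmallSource R A (suc s) → v ∈ A → ∃[ y ] (y ∈ A × y ≢ v × R y v)
in-neighbour {s = s} {v = v} noSource v∈A
  with noSource (x∈p⇒⁅x⁆⊆p v∈A) (v , x∈⁅x⁆ v) (subst (_≤ suc s) (sym (∣⁅x⁆∣≡1 v)) (s≤s z≤n))
... | y , t , y∈A , y∉⁅v⁆ , t∈⁅v⁆ , yt with x∈⁅y⁆⇒x≡y v t∈⁅v⁆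
... | refl = y , y∈A , x∉⁅y⁆⇒x≢y y∉⁅v⁆ , yt

module QuasiKernel {n} {R : Rel (Fin n) 0ℓ} (R? : Decidable R) where

  inClosedOutNbhd? : ∀ v → U.Decidable (λ u → v ≡ u ⊎ R v u)
  inClosedOutNbhd? v u = v ≟ u ⊎-dec R? v u

  closedOutNbhd : Fin n → Subset n
  closedOutNbhd v = select (inClosedOutNbhd? v)

  -- Chvátal–Lovász: either an in-neighbour of v in Q also absorbs v and its out-neighbours,
  -- or v is independent from Q and can be added to it.
  extend : v ∈ A → IsKernelIn R 2 (A ─ closedOutNbhd v) Q → ∃[ Q′ ] IsKernelIn R 2 A Q′
  extend {v} {A} {Q} v∈A (Q⊆ , Q-ind , Q-reach) with any? (λ w → w ∈? Q ×-dec R? w v)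
  ... | yes (w , w∈Q , wv) = Q , p─q⊆p A (closedOutNbhd v) ∘ Q⊆ , Q-ind , reach
    where
    reach : ReachesWithin R 2 Q A
    reach u∈A with x∈p⇒x∈p─q⊎x∈q (closedOutNbhd v) u∈A
    ... | inj₁ u∈A′ = Q-reach u∈A′
    ... | inj₂ u∈N with ∈-select⁻ (inClosedOutNbhd? v) u∈N
    ...   | inj₁ refl = w , w∈Q , arc⇒within wv
    ...   | inj₂ vu   = w , w∈Q , within-◅ wv (arc⇒within vu)
  ... | no ¬wv = ⁅ v ⁆ ∪ Q , Q′⊆A , ind , reach
    where
    Q′⊆A : ⁅ v ⁆ ∪ Q ⊆ A
    Q′⊆A x∈ with x∈⁅y⁆∪p⁻ x∈
    ... | inj₁ refl = v∈A
    ... | inj₂ x∈Q  = p─q⊆p A (closedOutNbhd v) (Q⊆ x∈Q)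
    ind : IndependentSet R (⁅ v ⁆ ∪ Q)
    ind u∈ w∈ u≢w uw with x∈⁅y⁆∪p⁻ u∈ | x∈⁅y⁆∪p⁻ w∈
    ... | inj₁ refl | inj₁ refl = u≢w refl
    ... | inj₁ refl | inj₂ w∈Q  = x∈p─q⇒x∉q A _ (Q⊆ w∈Q) (∈-select⁺ (inClosedOutNbhd? _) (inj₂ uw))
    ... | inj₂ u∈Q  | inj₁ refl = ¬wv (_ , u∈Q , uw)
    ... | inj₂ u∈Q  | inj₂ w∈Q  = Q-ind u∈Q w∈Q u≢w uw
    reach : ReachesWithin R 2 (⁅ v ⁆ ∪ Q) A
    reach u∈A with x∈p⇒x∈p─q⊎x∈q (closedOutNbhd v) u∈A
    ... | inj₁ u∈A′ = map₂ (map₁ (q⊆p∪q ⁅ v ⁆ Q)) (Q-reach u∈A′)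
    ... | inj₂ u∈N with ∈-select⁻ (inClosedOutNbhd? v) u∈N
    ...   | inj₁ refl = v , p⊆p∪q Q (x∈⁅x⁆ v) , within-refl
    ...   | inj₂ vu   = v , p⊆p∪q Q (x∈⁅x⁆ v) , arc⇒within vu

  quasiKernel : ∀ A → ∃[ Q ] IsKernelIn R 2 A Q
  quasiKernel A = go A ≤-refl
    where
    go : ∀ {k} A → ∣ A ∣ < k → ∃[ Q ] IsKernelIn R 2 A Q
    go {zero}  A ()
    go {suc k} A ∣A∣<1+k with nonempty? A
    ... | no A-empty = ⊥ , (λ x∈⊥ → contradiction x∈⊥ ∉⊥) , (λ x∈⊥ → contradiction x∈⊥ ∉⊥) , (λ v∈A → contradiction (_ , v∈A) A-empty)
    ... | yes (v , v∈A) = extend v∈A (proj₂ (go (A ─ closedOutNbhd v) (<-≤-trans shrinks (≤-pred ∣A∣<1+k))))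
      where
      shrinks : ∣ A ─ closedOutNbhd v ∣ < ∣ A ∣
      shrinks = p∩q≢∅⇒∣p─q∣<∣p∣ A _ (v , x∈p∩q⁺ (v∈A , ∈-select⁺ (inClosedOutNbhd? _) (inj₁ refl)))

Contract : Rel (Fin n) 0ℓ → Subset n → Rel (Fin n) 0ℓ
Contract R Q u w = R u w ⊎ ∃[ x ] (x ∈ Q × R u x × R x w)

contract? : Decidable R → ∀ Q → Decidable (Contract R Q)
contract? R? Q u w = R? u w ⊎-dec any? λ x → x ∈? Q ×-dec R? u x ×-dec R? x w

contract⇒within : Contract R Q u w → Within R 2 u w
contract⇒within (inj₁ uw)               = arc⇒within uw
contract⇒within (inj₂ (_ , _ , ux , xw)) = within-◅ ux (arc⇒within xw)

-- Indexed by r − 1: radius m bounds the reach of each of m + 1 kernels.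
radius : ℕ → ℕ
radius zero    = 2
radius (suc m) = radius m * 2 + 2

m≤radius : ∀ m → m ≤ radius m
m≤radius zero    = z≤n
m≤radius (suc m) = begin
  suc m                ≤⟨ n≤1+n (suc m) ⟩
  2 + m                ≡⟨ +-comm 2 m ⟩
  m + 2                ≤⟨ +-monoˡ-≤ 2 (≤-trans (m≤radius m) (m≤m*n (radius m) 2)) ⟩
  radius m * 2 + 2     ∎
  where open ≤-Reasoning

2*[1+m]≤radius[1+m] : ∀ m → 2 * suc m ≤ radius (suc m)
2*[1+m]≤radius[1+m] m = begin
  2 * suc m            ≡⟨ *-comm 2 (suc m) ⟩
  2 + m * 2            ≡⟨ +-comm 2 (m * 2) ⟩
  m * 2 + 2            ≤⟨ +-monoˡ-≤ 2 (*-monoˡ-≤ 2 (m≤radius m)) ⟩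
  radius m * 2 + 2     ∎
  where open ≤-Reasoning

radius+2≡2^[m+2] : ∀ m → radius m + 2 ≡ 2 ^ (suc m + 1)
radius+2≡2^[m+2] zero    = refl
radius+2≡2^[m+2] (suc m) = begin
  radius m * 2 + 2 + 2 ≡⟨ +-assoc (radius m * 2) 2 2 ⟩
  radius m * 2 + 2 * 2 ≡⟨ sym (*-distribʳ-+ 2 (radius m) 2) ⟩
  (radius m + 2) * 2   ≡⟨ cong (_* 2) (radius+2≡2^[m+2] m) ⟩
  2 ^ (suc m + 1) * 2  ≡⟨ *-comm (2 ^ (suc m + 1)) 2 ⟩
  2 ^ (suc (suc m) + 1) ∎
  where open ≡-Reasoning

module Peel {n} {R : Rel (Fin n) 0ℓ} (R? : Decidable R) {m : ℕ} {A Q : Subset n}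
            (Q-quasi : IsKernelIn (Within R (suc m)) 2 A Q) (noSource : NoSmallSource R A (suc m)) where

  Q-ind : IndependentSet (Within R (suc m)) Q
  Q-ind = proj₁ (proj₂ Q-quasi)

  Q-kernel : IsKernelIn R (radius (suc m)) A Q
  Q-kernel = proj₁ Q-quasi , independent-anti arc⇒within Q-ind , reach
    where
    reach : ReachesWithin R (radius (suc m)) Q A
    reach v∈A = map₂ (map₂ (within-mono (2*[1+m]≤radius[1+m] m) ∘ within-flatten id)) (proj₂ (proj₂ Q-quasi) v∈A)

  module _ {T : Subset n} {u t : Fin n} (T⊆A─Q : T ⊆ A ─ Q) (∣T∣≤m : ∣ T ∣ ≤ m)
           (u∈A : u ∈ A) (u∈Q : u ∈ Q) (t∈T : t ∈ T) (ut : R u t) where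

    reachers : ℕ → Subset n
    reachers k = T ∩ select (λ b → within? R? k b u)

    reachers⊆T : ∀ k → reachers k ⊆ T
    reachers⊆T k = p∩q⊆p T _

    reachers-within : ∀ k → x ∈ ⁅ u ⁆ ∪ reachers k → Within R k x u
    reachers-within k x∈ with x∈⁅y⁆∪p⁻ x∈
    ... | inj₁ refl = within-refl
    ... | inj₂ x∈r  = ∈-select⁻ (λ b → within? R? k b u) (proj₂ (x∈p∩q⁻ T _ x∈r))

    reachers-mono : ∀ k → reachers k ⊆ reachers (suc k)
    reachers-mono k x∈ = x∈p∩q⁺ (reachers⊆T k x∈ , ∈-select⁺ (λ b → within? R? (suc k) b u)
                             (within-mono (n≤1+n k) (reachers-within k (q⊆p∪q ⁅ u ⁆ _ x∈))))

    ⁅u⁆∪reachers⊆A : ∀ k → ⁅ u ⁆ ∪ reachers k ⊆ A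
    ⁅u⁆∪reachers⊆A k x∈ with x∈⁅y⁆∪p⁻ x∈
    ... | inj₁ refl = u∈A
    ... | inj₂ x∈r  = p─q⊆p A Q (T⊆A─Q (reachers⊆T k x∈r))

    ∣⁅u⁆∪reachers∣≤1+m : ∀ k → ∣ ⁅ u ⁆ ∪ reachers k ∣ ≤ suc m
    ∣⁅u⁆∪reachers∣≤1+m k = begin
      ∣ ⁅ u ⁆ ∪ reachers k ∣        ≤⟨ ∣p∪q∣≤∣p∣+∣q∣ ⁅ u ⁆ (reachers k) ⟩
      ∣ ⁅ u ⁆ ∣ + ∣ reachers k ∣    ≡⟨ cong (_+ ∣ reachers k ∣) (∣⁅x⁆∣≡1 u) ⟩
      suc ∣ reachers k ∣            ≤⟨ s≤s (≤-trans (p⊆q⇒∣p∣≤∣q∣ (reachers⊆T k)) ∣T∣≤m) ⟩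
      suc m                         ∎
      where open ≤-Reasoning

    -- The in-neighbour y of ⁅ u ⁆ ∪ reachers k is a new reacher, or a second vertex of Q
    -- within m + 1 steps of u, or (through u if need be) a contracted in-neighbour of T.
    reachers-grow : ¬ HasInNeighbour (Contract R Q) (A ─ Q) T → k ≤ m → reachers k ⊂ reachers (suc k)
    reachers-grow {k} T-source k≤m
      with noSource (⁅u⁆∪reachers⊆A k) (u , p⊆p∪q _ (x∈⁅x⁆ u)) (∣⁅u⁆∪reachers∣≤1+m k)
    ... | y , b , y∈A , y∉B , b∈B , yb with y ∈? T
    ... | yes y∈T = reachers-mono k , y , y∈reachers , y∉B ∘ q⊆p∪q ⁅ u ⁆ _
      where
      y∈reachers : y ∈ reachers (suc k)
      y∈reachers = x∈p∩q⁺ (y∈T , ∈-select⁺ (λ b → within? R? (suc k) b u) (within-◅ yb (reachers-within k b∈B)))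
    ... | no y∉T with y ∈? Q
    ...   | yes y∈Q = contradiction (within-mono (s≤s k≤m) (within-◅ yb (reachers-within k b∈B)))
                        (Q-ind y∈Q u∈Q λ { refl → y∉B (p⊆p∪q _ (x∈⁅x⁆ u)) })
    ...   | no  y∉Q with x∈⁅y⁆∪p⁻ b∈B
    ...     | inj₁ refl = contradiction (y , t , x∈p∧x∉q⇒x∈p─q y∈A y∉Q , y∉T , t∈T , inj₂ (u , u∈Q , yb , ut)) T-source
    ...     | inj₂ b∈r  = contradiction (y , b , x∈p∧x∉q⇒x∈p─q y∈A y∉Q , y∉T , reachers⊆T k b∈r , inj₁ yb) T-source

    contracted-in-neighbour : HasInNeighbour (Contract R Q) (A ─ Q) T
    contracted-in-neighbour = decidable-stable (hasInNeighbour? (contract? R? Q) (A ─ Q) T) λ T-source →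
      1+n≰n (≤-trans (strict-chain-size reachers (reachers-grow T-source ∘ ≤-pred))
                     (≤-trans (p⊆q⇒∣p∣≤∣q∣ (reachers⊆T (suc m))) ∣T∣≤m))

  noSmallSource-contract : NoSmallSource (Contract R Q) (A ─ Q) m
  noSmallSource-contract T⊆A─Q T≠∅ ∣T∣≤m with noSource (p─q⊆p A Q ∘ T⊆A─Q) T≠∅ (m≤n⇒m≤1+n ∣T∣≤m)
  ... | y , t , y∈A , y∉T , t∈T , yt with y ∈? Q
  ... | no  y∉Q = y , t , x∈p∧x∉q⇒x∈p─q y∈A y∉Q , y∉T , t∈T , inj₁ yt
  ... | yes y∈Q = contracted-in-neighbour T⊆A─Q ∣T∣≤m y∈A y∈Q t∈T yt

  lift-kernel : ∀ {K} → IsKernelIn (Contract R Q) (radius m) (A ─ Q) K → IsKernelIn R (radius (suc m)) A K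
  lift-kernel {K} (K⊆A─Q , K-ind , K-reach) = p─q⊆p A Q ∘ K⊆A─Q , independent-anti inj₁ K-ind , reach
    where
    reach-outside : v ∈ A ─ Q → ∃[ w ] (w ∈ K × Within R (radius m * 2) w v)
    reach-outside v∈ = map₂ (map₂ (within-flatten contract⇒within)) (K-reach v∈)
    -- A vertex of Q is entered by an arc from outside Q, as Q is independent.
    reach : ReachesWithin R (radius (suc m)) K A
    reach v∈A with x∈p⇒x∈p─q⊎x∈q Q v∈A
    ... | inj₁ v∈A─Q = map₂ (map₂ (within-mono (m≤m+n _ 2))) (reach-outside v∈A─Q)
    ... | inj₂ v∈Q with in-neighbour noSource v∈A
    ...   | y , y∈A , y≢v , yv with reach-outside (x∈p∧x∉q⇒x∈p─q y∈A λ y∈Q → Q-ind y∈Q v∈Q y≢v (arc⇒within yv))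
    ...     | w , w∈K , r = w , w∈K , within-mono (+-monoʳ-≤ (radius m * 2) (s≤s z≤n)) (within-◅◅ r (arc⇒within yv))

MutuallyDisjoint : ∀ {r} → (Fin r → Subset n) → Set
MutuallyDisjoint {r = r} K = ∀ (i j : Fin r) → i ≢ j → ∀ v → v ∈ K i → v ∉ K j

disjoint-∷ : ∀ {r} {K : Fin r → Subset n} → (∀ i → K i ⊆ A ─ Q) → MutuallyDisjoint K → MutuallyDisjoint (Q Vector.∷ K)
disjoint-∷ K⊆A─Q K-disj zero    zero    0≢0 = contradiction refl 0≢0
disjoint-∷ K⊆A─Q K-disj zero    (suc j) _   v v∈Q v∈K = x∈p─q⇒x∉q _ _ (K⊆A─Q j v∈K) v∈Q
disjoint-∷ K⊆A─Q K-disj (suc i) zero    _   v v∈K v∈Q = x∈p─q⇒x∉q _ _ (K⊆A─Q i v∈K) v∈Q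
disjoint-∷ K⊆A─Q K-disj (suc i) (suc j) i≢j = K-disj i j (i≢j ∘ cong suc)

disjointKernels : Decidable R → ∀ m {A} → NoSmallSource R A m →
  ∃[ K ] (MutuallyDisjoint {r = suc m} K × ∀ i → IsKernelIn R (radius m) A (K i))
disjointKernels R? zero {A} _ with QuasiKernel.quasiKernel R? A
... | Q , Q-kernel = (λ _ → Q) , (λ { zero zero 0≢0 → contradiction refl 0≢0 }) , (λ _ → Q-kernel)
disjointKernels R? (suc m) {A} noSource with QuasiKernel.quasiKernel (within? R? (suc m)) A
... | Q , Q-quasi with disjointKernels (contract? R? Q) m (Peel.noSmallSource-contract R? Q-quasi noSource)
... | K , K-disj , K-kernel =
  Q Vector.∷ K , disjoint-∷ (proj₁ ∘ K-kernel) K-disj , λ { zero → Q-kernel ; (suc i) → lift-kernel (K-kernel i) }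
  where open Peel R? Q-quasi noSource

module _ (D : Digraph) where

  arc-dec : Decidable (Arc D)
  arc-dec u v = arc? D u v Bool.≟ true

  noSmallSource-⊤ : NoSSourceSet D s → NoSmallSource (Arc D) ⊤ s
  noSmallSource-⊤ noSSource {T} _ T≠∅ ∣T∣≤s = decidable-stable (hasInNeighbour? arc-dec ⊤ T) λ no-in-neighbour →
    noSSource T ((λ { y (y∉T , t , t∈T , yt) → no-in-neighbour (y , t , ∈⊤ , y∉T , t∈T , yt) }) , T≠∅ , ∣T∣≤s)

  toDigraphWalk : Walk (Arc D) u v k → DigraphWalk D u v k
  toDigraphWalk []      = here
  toDigraphWalk (e ◅ p) = step e (toDigraphWalk p)

  toQKernel : q ≤ q′ → IsKernelIn (Arc D) q ⊤ Q → IsQKernel D q′ Q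
  toQKernel {q = q} {q′ = q′} {Q = Q} q≤q′ (_ , Q-ind , Q-reach) = independent , λ v → distance (Q-reach ∈⊤)
    where
    independent : Independent D Q
    independent u v u∈Q v∈Q uv with u ≟ v
    ... | yes refl = contradiction (trans (sym uv) (loopless D u)) λ ()
    ... | no  u≢v  = Q-ind u∈Q v∈Q u≢v uv
    distance : ∃[ u ] (u ∈ Q × Within (Arc D) q u v) → DistSetLe D Q v q′
    distance (u , u∈Q , k , k≤q , p) = u , u∈Q , k , ≤-trans k≤q q≤q′ , toDigraphWalk p

theorem2p4 : (r : ℕ) → 1 ≤ r → (D : Digraph) → NoSSourceSet D (r ∸ 1) →
    ∃[ K ] (PairwiseDisjoint D {r} K × (∀ i → IsQKernel D (2 ^ (r + 1)) (K i)))
theorem2p4 zero    ()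
theorem2p4 (suc m) _ D noSSource with disjointKernels (arc-dec D) m (noSmallSource-⊤ D noSSource)
... | K , K-disj , K-kernel = K , K-disj , λ i → toQKernel D radius≤2^[m+2] (K-kernel i)
  where
  radius≤2^[m+2] : radius m ≤ 2 ^ (suc m + 1)
  radius≤2^[m+2] = ≤-trans (m≤m+n (radius m) 2) (≤-reflexive (radius+2≡2^[m+2] m))
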